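{- Let $p_1<p_2<p_3$ be odd primes with $p_2\equiv 1 \pmod{p_1}$ and $p_3\equiv 1\pmod{p_1p_2}$, let $q_2=(p_2-1)/p_1$, $q_3=(p_3-1)/(p_1p_2)$, $$I=\{0,\ldots,p_1-2\}\times\{0,\ldots,q_2-1\}\times\{0,\ldots,p_1-1\}\times\{0,\ldots,q_3-1\},\quad \rho=\big((p_2-1)(p_3-1),\ p_1(p_3-1),\ p_3-1,\ p_1p_2\big),$$ and $i\cdot\rho=\sum_{j=1}^4 i_j\rho_j$. Then there exist polynomials $f_i\in\mathbb{Z}[x]$, $i\in I$, each with $\deg f_i<\rho_4=p_1p_2$, such that $$\Phi_{p_1p_2p_3}=\sum_{i\in I}f_i\,x^{i\cdot\rho}+x^{\varphi(p_1p_2p_3)}.$$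
   Context: $\Phi_n$ denotes the $n$-th cyclotomic polynomial and $\varphi$ is Euler's totient function. -}

module Defs where

open import Data.Bool using (Bool; true; false; if_then_else_)
open import Data.Nat as ℕ using (ℕ; zero; suc; _∸_; _<ᵇ_; _≡ᵇ_)
open import Data.Nat.Divisibility using (_∣?_)
open import Data.Nat.GCD using (gcd)
open import Data.Integer as ℤ using (ℤ; +_; -_)
open import Data.List using (List; []; _∷_; _++_; length; replicate; reverse; map)
open import Data.Fin using (Fin)
open import Data.Product using (_×_; _,_)
open import Relation.Nullary using (does)

-- Integer polynomials as little-endian coefficient lists (index j = coeff of x^j).
-- Trailing zeros are allowed; polynomials are compared via `coeff`.
Poly : Set
Poly = List ℤ

coeff : Poly → ℕ → ℤ
coeff []       _       = + 0
coeff (a ∷ _)  zero    = a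
coeff (_ ∷ as) (suc k) = coeff as k

infixl 6 _+P_ _-P_
infixl 7 _*P_

_+P_ : Poly → Poly → Poly
[]       +P q        = q
(a ∷ p)  +P []       = a ∷ p
(a ∷ p)  +P (b ∷ q)  = (a ℤ.+ b) ∷ (p +P q)

negP : Poly → Poly
negP = map (-_)

_-P_ : Poly → Poly → Poly
p -P q = p +P negP q

_*P_ : Poly → Poly → Poly
[]      *P q = []
(a ∷ p) *P q = map (a ℤ.*_) q +P (+ 0 ∷ (p *P q))

shift : ℕ → Poly → Poly
shift n p = replicate n (+ 0) ++ p

xpow : ℕ → Poly
xpow n = shift n (+ 1 ∷ [])

isZero : ℤ → Bool
isZero (+ zero) = true
isZero _        = false

dropZeros : List ℤ → List ℤ
dropZeros []       = []
dropZeros (a ∷ as) = if isZero a then dropZeros as else a ∷ as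

trim : Poly → Poly
trim p = reverse (dropZeros (reverse p))

lastCoeff : Poly → ℤ
lastCoeff []           = + 0
lastCoeff (a ∷ [])     = a
lastCoeff (_ ∷ b ∷ bs) = lastCoeff (b ∷ bs)

-- Long division of a by a monic (trimmed) polynomial b, with fuel;
-- returns the quotient.
divMonic : ℕ → Poly → Poly → Poly
divMonic zero    a b = []
divMonic (suc f) a b =
  let a' = trim a in
  if length a' <ᵇ length b then []
  else (let t = shift (length a' ∸ length b) (lastCoeff a' ∷ [])
        in t +P divMonic f (a' -P t *P b) b)

prodP : List Poly → Poly
prodP []       = + 1 ∷ []
prodP (p ∷ ps) = p *P prodP ps

divisorProd : ℕ → List (ℕ × Poly) → Poly
divisorProd m []             = + 1 ∷ []
divisorProd m ((d , P) ∷ ts) =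
  if does (d ∣? m) then P *P divisorProd m ts else divisorProd m ts

-- table [(1 , Φ_1) , … , (n , Φ_n)] built by the standard recursion
-- x^m - 1 = ∏_{d ∣ m} Φ_d , i.e. Φ_m = (x^m - 1) / ∏_{d ∣ m, d < m} Φ_d
cycTable : ℕ → List (ℕ × Poly)
cycTable zero    = []
cycTable (suc n) =
  let tbl = cycTable n
      m   = suc n
  in tbl ++ ((m , divMonic (suc m) (xpow m -P (+ 1 ∷ [])) (trim (divisorProd m tbl))) ∷ [])

lookupTable : ℕ → List (ℕ × Poly) → Poly
lookupTable n []             = []
lookupTable n ((d , P) ∷ ts) = if d ≡ᵇ n then P else lookupTable n ts

Φ : ℕ → Poly
Φ n = lookupTable n (cycTable n)

countCoprime : ℕ → ℕ → ℕ
countCoprime zero    n = 0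
countCoprime (suc k) n = (if gcd (suc k) n ≡ᵇ 1 then 1 else 0) ℕ.+ countCoprime k n

φ : ℕ → ℕ
φ n = countCoprime n n

sumP : (n : ℕ) → (Fin n → Poly) → Poly
sumP zero    g = []
sumP (suc n) g = g Fin.zero +P sumP n (λ i → g (Fin.suc i))
  where import Data.Fin as Fin

fromCoeffs : (m : ℕ) → (Fin m → ℤ) → Poly
fromCoeffs zero    c = []
fromCoeffs (suc m) c = c Fin.zero ∷ fromCoeffs m (λ j → c (Fin.suc j))
  where import Data.Fin as Fin

{-# OPTIONS --safe #-}
-- Φ N is monic of degree φ N: by its recursive definition Φ m is the quotient of
-- x^m − 1 by the product of the Φ d over the proper divisors d of m, which by induction is
-- monic of degree ∑_{d ∣ m, d < m} φ d = m − φ m (Gauss: ∑_{d ∣ m} φ d = m), so long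
-- division leaves a monic quotient of degree φ m.
-- For N = p₁p₂p₃ we have φ N = (p₁ − 1)ρ₁ and ρ₁ = q₂ρ₂, ρ₂ = p₁ρ₃, ρ₃ = q₃ρ₄, so the
-- intervals [i·ρ, i·ρ + ρ₄) for i ∈ I tile [0, φ N) in mixed radix. Taking for f_i the
-- coefficients of Φ N in the i-th interval, ∑ f_i x^{i·ρ} is Φ N below degree φ N, and
-- x^{φ N} supplies the leading coefficient.
module Submission where

open import Defs
open import Algebra.Properties.CommutativeSemigroup using (interchange)
open import Data.Bool using (true; false; if_then_else_)
open import Data.Empty using (⊥-elim)
open import Data.Fin using (Fin; toℕ)
import Data.Fin as Fin
open import Data.Integer using (ℤ; 0ℤ; 1ℤ; -_) renaming (_+_ to _+ℤ_; _-_ to _-ℤ_; _*_ to _*ℤ_)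
import Data.Integer as ℤ
import Data.Integer.Properties as ℤₚ
open import Data.List using ([]; _∷_; _++_; _∷ʳ_; length; map; reverse)
open import Data.List.Properties using (++-assoc; ++-identityʳ; reverse-++; unfold-reverse)
open import Data.Nat
open import Data.Nat.Coprimality using (Coprime; coprime?; coprime-divisor; gcd≡1⇒coprime; coprime⇒gcd≡1)
open import Data.Nat.Divisibility
open import Data.Nat.GCD
open import Data.Nat.Primality using (Prime; euclidsLemma; prime⇒irreducible; prime⇒nonZero; prime⇒nonTrivial)
open import Data.Nat.Properties
open import Data.Nat.Solver using (module +-*-Solver)
open import Data.Product using (_×_; _,_; proj₁; proj₂; Σ-syntax)
open import Data.Sum using (inj₁; inj₂)
open import Function.Base using (_∘_; it)
open import Function.Bundles using (_⇔_; mk⇔)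
open import Function.Construct.Composition using (_⇔-∘_)
open import Relation.Binary.PropositionalEquality
open import Relation.Nullary using (¬_; Dec; does; yes; no; _×-dec_)
open import Relation.Nullary.Decidable using (dec-true; dec-false; does-⇔)

-- Finite sums and Euler's totient

∑₁ : (ℕ → ℕ) → ℕ → ℕ
∑₁ f zero    = 0
∑₁ f (suc n) = f (suc n) + ∑₁ f n

𝟙 : {A : Set} → Dec A → ℕ
𝟙 a? = if does a? then 1 else 0

𝟙-⇔ : {A B : Set} → A ⇔ B → (a? : Dec A) (b? : Dec B) → 𝟙 a? ≡ 𝟙 b?
𝟙-⇔ A⇔B a? b? = cong (if_then 1 else 0) (does-⇔ A⇔B a? b?)

𝟙-yes : {A : Set} (a? : Dec A) → A → 𝟙 a? ≡ 1
𝟙-yes a? a = cong (if_then 1 else 0) (dec-true a? a)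

𝟙-no : {A : Set} (a? : Dec A) → ¬ A → 𝟙 a? ≡ 0
𝟙-no a? ¬a = cong (if_then 1 else 0) (dec-false a? ¬a)

∑₁-cong : ∀ {f g} n → (∀ i → i < n → f (suc i) ≡ g (suc i)) → ∑₁ f n ≡ ∑₁ g n
∑₁-cong zero    eq = refl
∑₁-cong (suc n) eq = cong₂ _+_ (eq n ≤-refl) (∑₁-cong n (λ i i<n → eq i (m<n⇒m<1+n i<n)))

∑₁-zero : ∀ {f} n → (∀ i → i < n → f (suc i) ≡ 0) → ∑₁ f n ≡ 0
∑₁-zero zero    eq = refl
∑₁-zero (suc n) eq = cong₂ _+_ (eq n ≤-refl) (∑₁-zero n (λ i i<n → eq i (m<n⇒m<1+n i<n)))

∑₁-one : ∀ n → ∑₁ (λ _ → 1) n ≡ n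
∑₁-one zero    = refl
∑₁-one (suc n) = cong suc (∑₁-one n)

∑₁-distrib-+ : ∀ f g n → ∑₁ (λ i → f i + g i) n ≡ ∑₁ f n + ∑₁ g n
∑₁-distrib-+ f g zero    = refl
∑₁-distrib-+ f g (suc n) = begin
  f (suc n) + g (suc n) + ∑₁ (λ i → f i + g i) n  ≡⟨ cong ((f (suc n) + g (suc n)) +_) (∑₁-distrib-+ f g n) ⟩
  f (suc n) + g (suc n) + (∑₁ f n + ∑₁ g n)       ≡⟨ interchange +-commutativeSemigroup (f (suc n)) _ (∑₁ f n) _ ⟩
  ∑₁ f (suc n) + ∑₁ g (suc n)                     ∎
  where open ≡-Reasoning

∑₁-comm : ∀ (F : ℕ → ℕ → ℕ) m n → ∑₁ (λ d → ∑₁ (F d) n) m ≡ ∑₁ (λ j → ∑₁ (λ d → F d j) m) n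
∑₁-comm F zero    n = sym (∑₁-zero n (λ _ _ → refl))
∑₁-comm F (suc m) n = begin
  ∑₁ (F (suc m)) n + ∑₁ (λ d → ∑₁ (F d) n) m          ≡⟨ cong (∑₁ (F (suc m)) n +_) (∑₁-comm F m n) ⟩
  ∑₁ (F (suc m)) n + ∑₁ (λ j → ∑₁ (λ d → F d j) m) n  ≡⟨ ∑₁-distrib-+ (F (suc m)) _ n ⟨
  ∑₁ (λ j → ∑₁ (λ d → F d j) (suc m)) n               ∎
  where open ≡-Reasoning

∑₁-+ : ∀ f a b → ∑₁ f (a + b) ≡ ∑₁ (λ t → f (a + t)) b + ∑₁ f a
∑₁-+ f a zero    = cong (∑₁ f) (+-identityʳ a)
∑₁-+ f a (suc b) = begin
  ∑₁ f (a + suc b)                                     ≡⟨ cong (∑₁ f) (+-suc a b) ⟩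
  f (suc (a + b)) + ∑₁ f (a + b)                       ≡⟨ cong (f (suc (a + b)) +_) (∑₁-+ f a b) ⟩
  f (suc (a + b)) + (∑₁ (λ t → f (a + t)) b + ∑₁ f a)  ≡⟨ +-assoc (f (suc (a + b))) _ _ ⟨
  f (suc (a + b)) + ∑₁ (λ t → f (a + t)) b + ∑₁ f a    ≡⟨ cong (λ x → f x + ∑₁ f⟨a+⟩ b + ∑₁ f a) (+-suc a b) ⟨
  ∑₁ (λ t → f (a + t)) (suc b) + ∑₁ f a                ∎
  where
  open ≡-Reasoning
  f⟨a+⟩ : ℕ → ℕ
  f⟨a+⟩ t = f (a + t)

∑₁-multiples : ∀ e .{{_ : NonZero e}} (f : ℕ → ℕ) → (∀ j → ¬ e ∣ j → f j ≡ 0) →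
               ∀ d → ∑₁ f (d * e) ≡ ∑₁ (λ i → f (i * e)) d
∑₁-multiples e f f≡0 zero    = refl
∑₁-multiples e@(suc e′) f f≡0 (suc d) = begin
  ∑₁ f (e + d * e)                                 ≡⟨ cong (∑₁ f) (+-comm e (d * e)) ⟩
  ∑₁ f (d * e + e)                                 ≡⟨ ∑₁-+ f (d * e) e ⟩
  f (d * e + e) + ∑₁ (λ t → f (d * e + t)) e′ + ∑₁ f (d * e)
    ≡⟨ cong₂ (λ x y → f x + y + ∑₁ f (d * e)) (+-comm (d * e) e) (∑₁-zero e′ off-multiple) ⟩
  f (e + d * e) + 0 + ∑₁ f (d * e)
    ≡⟨ cong₂ _+_ (+-identityʳ (f (e + d * e))) (∑₁-multiples e f f≡0 d) ⟩
  ∑₁ (λ i → f (i * e)) (suc d)                     ∎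
  where
  open ≡-Reasoning
  off-multiple : ∀ i → i < e′ → f (d * e + suc i) ≡ 0
  off-multiple i i<e′ = f≡0 _ (λ e∣ → <⇒≱ (s<s i<e′) (∣⇒≤ (∣m+n∣m⇒∣n e∣ (n∣m*n d))))

∑₁-𝟙-≟ : ∀ {q} n → 0 < q → q ≤ n → ∑₁ (λ d → 𝟙 (d ≟ q)) n ≡ 1
∑₁-𝟙-≟ zero    0<q q≤0   = ⊥-elim (<⇒≱ 0<q q≤0)
∑₁-𝟙-≟ {q} (suc n) 0<q q≤1+n with m≤n⇒m<n∨m≡n q≤1+n
... | inj₂ refl  = cong₂ _+_ (𝟙-yes (suc n ≟ q) refl)
                             (∑₁-zero n (λ i i<n → 𝟙-no (suc i ≟ q) (<⇒≢ (s<s i<n))))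
... | inj₁ q<1+n = cong₂ _+_ (𝟙-no (suc n ≟ q) (>⇒≢ q<1+n)) (∑₁-𝟙-≟ n 0<q (s≤s⁻¹ q<1+n))

φ≡∑₁-coprime : ∀ n → φ n ≡ ∑₁ (λ j → 𝟙 (coprime? j n)) n
φ≡∑₁-coprime n = count n
  where
  count : ∀ k → countCoprime k n ≡ ∑₁ (λ j → 𝟙 (coprime? j n)) k
  count zero    = refl
  count (suc k) = cong₂ _+_ (𝟙-⇔ (mk⇔ gcd≡1⇒coprime coprime⇒gcd≡1) (gcd (suc k) n ≟ 1) (coprime? (suc k) n))
                            (count k)

∑₁-gcd-cofactor : ∀ {m} .{{_ : NonZero m}} j .{{_ : NonZero j}} → ∑₁ (λ d → 𝟙 (gcd j m * d ≟ m)) m ≡ 1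
∑₁-gcd-cofactor {m} j with gcd[m,n]∣n j m
... | divides q m≡q*g = begin
  ∑₁ (λ d → 𝟙 (g * d ≟ m)) m  ≡⟨ ∑₁-cong m (λ d _ → 𝟙-⇔ cofactor (g * suc d ≟ m) (suc d ≟ q)) ⟩
  ∑₁ (λ d → 𝟙 (d ≟ q)) m      ≡⟨ ∑₁-𝟙-≟ m (n≢0⇒n>0 q≢0) (∣⇒≤ (divides g m≡g*q)) ⟩
  1                            ∎
  where
  open ≡-Reasoning
  g = gcd j m
  instance
    g≢0 : NonZero g
    g≢0 = ≢-nonZero (gcd[m,n]≢0 j m (inj₁ (≢-nonZero⁻¹ j)))
  m≡g*q : m ≡ g * q
  m≡g*q = trans m≡q*g (*-comm q g)
  cofactor : ∀ {d} → g * d ≡ m ⇔ d ≡ q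
  cofactor {d} = mk⇔ (λ g*d≡m → *-cancelˡ-≡ d q g (trans g*d≡m m≡g*q)) (λ { refl → sym m≡g*q })
  q≢0 : q ≢ 0
  q≢0 refl = ≢-nonZero⁻¹ m m≡q*g

∑₁-gcd-cofactor≡φ : ∀ e d .{{_ : NonZero e}} .{{_ : NonZero d}} →
                    ∑₁ (λ j → 𝟙 (gcd j (e * d) * d ≟ e * d)) (e * d) ≡ φ d
∑₁-gcd-cofactor≡φ e d = begin
  ∑₁ F (e * d)                    ≡⟨ cong (∑₁ F) (*-comm e d) ⟩
  ∑₁ F (d * e)                    ≡⟨ ∑₁-multiples e F F-off-multiples d ⟩
  ∑₁ (λ i → F (i * e)) d          ≡⟨ ∑₁-cong d (λ i _ → 𝟙-⇔ cofactor≡d⇔coprime (_ ≟ e * d) (coprime? (suc i) d)) ⟩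
  ∑₁ (λ i → 𝟙 (coprime? i d)) d   ≡⟨ φ≡∑₁-coprime d ⟨
  φ d                             ∎
  where
  open ≡-Reasoning
  F : ℕ → ℕ
  F j = 𝟙 (gcd j (e * d) * d ≟ e * d)
  F-off-multiples : ∀ j → ¬ e ∣ j → F j ≡ 0
  F-off-multiples j e∤j = 𝟙-no (gcd j (e * d) * d ≟ e * d)
                               (λ eq → e∤j (subst (_∣ j) (*-cancelʳ-≡ _ e d eq) (gcd[m,n]∣m j (e * d))))
  cofactor≡d⇔coprime : ∀ {i} → gcd (i * e) (e * d) * d ≡ e * d ⇔ Coprime i d
  cofactor≡d⇔coprime {i} = mk⇔ (gcd≡1⇒coprime ∘ to) (from ∘ coprime⇒gcd≡1)
    where
    gcd[ie,ed] : gcd (i * e) (e * d) ≡ e * gcd i d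
    gcd[ie,ed] = trans (cong (λ x → gcd x (e * d)) (*-comm i e)) (sym (c*gcd[m,n]≡gcd[cm,cn] e i d))
    to : gcd (i * e) (e * d) * d ≡ e * d → gcd i d ≡ 1
    to eq = *-cancelˡ-≡ _ 1 e (*-cancelʳ-≡ _ _ d (begin
      e * gcd i d * d            ≡⟨ cong (_* d) gcd[ie,ed] ⟨
      gcd (i * e) (e * d) * d    ≡⟨ eq ⟩
      e * d                      ≡⟨ cong (_* d) (*-identityʳ e) ⟨
      e * 1 * d                  ∎))
    from : gcd i d ≡ 1 → gcd (i * e) (e * d) * d ≡ e * d
    from eq = begin
      gcd (i * e) (e * d) * d    ≡⟨ cong (_* d) gcd[ie,ed] ⟩
      e * gcd i d * d            ≡⟨ cong (λ x → e * x * d) eq ⟩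
      e * 1 * d                  ≡⟨ cong (_* d) (*-identityʳ e) ⟩
      e * d                      ∎

∑φ-divisors : ℕ → ℕ → ℕ
∑φ-divisors m n = ∑₁ (λ d → if does (d ∣? m) then φ d else 0) n

-- Count the pairs (d, j) in [1, m]² with gcd j m * d ≡ m: each d ∣ m has φ d partners j,
-- each j has exactly one partner d.
∑φ-divisors≡id : ∀ m .{{_ : NonZero m}} → ∑φ-divisors m m ≡ m
∑φ-divisors≡id m = begin
  ∑φ-divisors m m                               ≡⟨ ∑₁-cong m (λ d _ → φ-as-count (suc d)) ⟩
  ∑₁ (λ d → ∑₁ (F d) m) m                       ≡⟨ ∑₁-comm F m m ⟩
  ∑₁ (λ j → ∑₁ (λ d → F d j) m) m               ≡⟨ ∑₁-cong m (λ j _ → ∑₁-gcd-cofactor (suc j)) ⟩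
  ∑₁ (λ _ → 1) m                                ≡⟨ ∑₁-one m ⟩
  m                                             ∎
  where
  open ≡-Reasoning
  F : ℕ → ℕ → ℕ
  F d j = 𝟙 (gcd j m * d ≟ m)
  φ-as-count : ∀ d .{{_ : NonZero d}} → (if does (d ∣? m) then φ d else 0) ≡ ∑₁ (F d) m
  φ-as-count d with d ∣? m
  ... | no d∤m = sym (∑₁-zero m (λ j _ → 𝟙-no (gcd (suc j) m * d ≟ m) (d∤m ∘ divides (gcd (suc j) m) ∘ sym)))
  ... | yes (divides e m≡e*d) =
    sym (subst (λ n → ∑₁ (λ j → 𝟙 (gcd j n * d ≟ n)) n ≡ φ d) (sym m≡e*d)
               (∑₁-gcd-cofactor≡φ e d {{m*n≢0⇒m≢0 e {{subst NonZero m≡e*d it}}}}))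

prime⇒≢1 : ∀ {p} → Prime p → p ≢ 1
prime⇒≢1 pp = nonTrivial⇒≢1 {{prime⇒nonTrivial pp}}

prime∤⇒coprime : ∀ {p n} → Prime p → ¬ p ∣ n → Coprime p n
prime∤⇒coprime pp p∤n (d∣p , d∣n) with prime⇒irreducible pp d∣p
... | inj₁ d≡1    = d≡1
... | inj₂ refl   = ⊥-elim (p∤n d∣n)

coprime[km+t,m]⇔coprime[t,m] : ∀ k {m t} → Coprime (k * m + t) m ⇔ Coprime t m
coprime[km+t,m]⇔coprime[t,m] k = mk⇔
  (λ c {_} (d∣t , d∣m) → c (∣m∣n⇒∣m+n (∣n⇒∣m*n k d∣m) d∣t , d∣m))
  (λ c {_} (d∣km+t , d∣m) → c (∣m+n∣m⇒∣n d∣km+t (∣n⇒∣m*n k d∣m) , d∣m))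

coprime[ip,m]⇔coprime[i,m] : ∀ {i p m} → Coprime p m → Coprime (i * p) m ⇔ Coprime i m
coprime[ip,m]⇔coprime[i,m] {i} {p} p⊥m = mk⇔
  (λ c {_} (d∣i , d∣m) → c (∣m⇒∣m*n p d∣i , d∣m))
  (λ c {d} (d∣ip , d∣m) → c (coprime-divisor (λ (e∣d , e∣p) → p⊥m (e∣p , ∣-trans e∣d d∣m))
                                             (subst (d ∣_) (*-comm i p) d∣ip) , d∣m))

coprime[j,pm]⇔coprime[j,m] : ∀ {j p m} → Coprime p j → Coprime j (p * m) ⇔ Coprime j m
coprime[j,pm]⇔coprime[j,m] {j} {p} p⊥j = mk⇔
  (λ c {_} (d∣j , d∣m) → c (d∣j , ∣n⇒∣m*n p d∣m))
  (λ c {_} (d∣j , d∣pm) → c (d∣j , coprime-divisor (λ (e∣d , e∣p) → p⊥j (e∣p , ∣-trans e∣d d∣j)) d∣pm))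

∑₁-coprime-periodic : ∀ m k → ∑₁ (λ j → 𝟙 (coprime? j m)) (k * m) ≡ k * φ m
∑₁-coprime-periodic m zero    = refl
∑₁-coprime-periodic m (suc k) = begin
  ∑₁ A (m + k * m)                           ≡⟨ cong (∑₁ A) (+-comm m (k * m)) ⟩
  ∑₁ A (k * m + m)                           ≡⟨ ∑₁-+ A (k * m) m ⟩
  ∑₁ (λ t → A (k * m + t)) m + ∑₁ A (k * m)  ≡⟨ cong₂ _+_ (∑₁-cong m (λ t _ → shift-invariant (suc t)))
                                                         (∑₁-coprime-periodic m k) ⟩
  ∑₁ A m + k * φ m                           ≡⟨ cong (_+ k * φ m) (φ≡∑₁-coprime m) ⟨
  suc k * φ m                                ∎
  where
  open ≡-Reasoning
  A : ℕ → ℕ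
  A j = 𝟙 (coprime? j m)
  shift-invariant : ∀ t → A (k * m + t) ≡ A t
  shift-invariant t = 𝟙-⇔ (coprime[km+t,m]⇔coprime[t,m] k) (coprime? (k * m + t) m) (coprime? t m)

-- Of the p * φ m numbers j ≤ p * m coprime to m, those with p ∤ j are exactly the ones coprime
-- to p * m, and those with p ∣ j are the i * p with i ≤ m coprime to m.
φ-*-prime : ∀ {p} m → Prime p → ¬ p ∣ m → φ (p * m) ≡ (p ∸ 1) * φ m
φ-*-prime {p} m pp p∤m = cancel p φ[pm]+φ[m]≡p*φ[m]
  where
  open ≡-Reasoning
  instance
    p≢0 : NonZero p
    p≢0 = prime⇒nonZero pp
  A C B : ℕ → ℕ
  A j = 𝟙 (coprime? j m)
  C j = 𝟙 (coprime? j (p * m))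
  B j = 𝟙 (p ∣? j ×-dec coprime? j m)
  split : ∀ j → C j + B j ≡ A j
  split j with p ∣? j
  ... | yes p∣j = cong (_+ A j) (𝟙-no (coprime? j (p * m)) (λ c → prime⇒≢1 pp (c (p∣j , m∣m*n m))))
  ... | no  p∤j = trans (+-identityʳ (C j))
                        (𝟙-⇔ (coprime[j,pm]⇔coprime[j,m] (prime∤⇒coprime pp p∤j)) (coprime? j _) (coprime? j m))
  B-off-multiples : ∀ j → ¬ p ∣ j → B j ≡ 0
  B-off-multiples j p∤j = 𝟙-no (p ∣? j ×-dec coprime? j m) (p∤j ∘ proj₁)
  B-on-multiples : ∀ i → B (i * p) ≡ A i
  B-on-multiples i = 𝟙-⇔ (coprime[ip,m]⇔coprime[i,m] (prime∤⇒coprime pp p∤m) ⇔-∘ mk⇔ proj₂ (n∣m*n i ,_))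
                         (p ∣? i * p ×-dec coprime? (i * p) m) (coprime? i m)
  φ[pm]+φ[m]≡p*φ[m] : φ (p * m) + φ m ≡ p * φ m
  φ[pm]+φ[m]≡p*φ[m] = begin
    φ (p * m) + φ m                     ≡⟨ cong₂ _+_ (φ≡∑₁-coprime (p * m)) (φ≡∑₁-coprime m) ⟩
    ∑₁ C (p * m) + ∑₁ A m               ≡⟨ cong (∑₁ C (p * m) +_) (∑₁-cong m (λ i _ → B-on-multiples (suc i))) ⟨
    ∑₁ C (p * m) + ∑₁ (λ i → B (i * p)) m ≡⟨ cong (∑₁ C (p * m) +_) (∑₁-multiples p B B-off-multiples m) ⟨
    ∑₁ C (p * m) + ∑₁ B (m * p)         ≡⟨ cong (λ n → ∑₁ C (p * m) + ∑₁ B n) (*-comm m p) ⟩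
    ∑₁ C (p * m) + ∑₁ B (p * m)         ≡⟨ ∑₁-distrib-+ C B (p * m) ⟨
    ∑₁ (λ j → C j + B j) (p * m)        ≡⟨ ∑₁-cong (p * m) (λ j _ → split (suc j)) ⟩
    ∑₁ A (p * m)                        ≡⟨ ∑₁-coprime-periodic m p ⟩
    p * φ m                             ∎
  cancel : ∀ p .{{_ : NonZero p}} → φ (p * m) + φ m ≡ p * φ m → φ (p * m) ≡ (p ∸ 1) * φ m
  cancel (suc p′) eq = +-cancelʳ-≡ (φ m) _ _ (trans eq (+-comm (φ m) (p′ * φ m)))

φ-prime : ∀ {p} → Prime p → φ p ≡ p ∸ 1
φ-prime {p} pp = begin
  φ p             ≡⟨ cong φ (*-identityʳ p) ⟨
  φ (p * 1)       ≡⟨ φ-*-prime 1 pp (prime⇒≢1 pp ∘ ∣1⇒≡1) ⟩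
  (p ∸ 1) * 1     ≡⟨ *-identityʳ (p ∸ 1) ⟩
  p ∸ 1           ∎
  where open ≡-Reasoning

φ[p₁p₂p₃] : ∀ {p₁ p₂ p₃} → Prime p₁ → Prime p₂ → Prime p₃ → p₁ < p₂ → p₂ < p₃ →
            φ (p₁ * p₂ * p₃) ≡ (p₁ ∸ 1) * ((p₂ ∸ 1) * (p₃ ∸ 1))
φ[p₁p₂p₃] {p₁} {p₂} {p₃} pp₁ pp₂ pp₃ p₁<p₂ p₂<p₃ = begin
  φ (p₁ * p₂ * p₃)                            ≡⟨ cong φ (trans (*-assoc p₁ p₂ p₃) (reverse₃ p₁ p₂ p₃)) ⟩
  φ (p₃ * (p₂ * p₁))                          ≡⟨ φ-*-prime (p₂ * p₁) pp₃ p₃∤p₂p₁ ⟩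
  (p₃ ∸ 1) * φ (p₂ * p₁)                      ≡⟨ cong ((p₃ ∸ 1) *_) (φ-*-prime p₁ pp₂ p₂∤p₁) ⟩
  (p₃ ∸ 1) * ((p₂ ∸ 1) * φ p₁)                ≡⟨ cong (λ x → (p₃ ∸ 1) * ((p₂ ∸ 1) * x)) (φ-prime pp₁) ⟩
  (p₃ ∸ 1) * ((p₂ ∸ 1) * (p₁ ∸ 1))            ≡⟨ reverse₃ (p₁ ∸ 1) (p₂ ∸ 1) (p₃ ∸ 1) ⟨
  (p₁ ∸ 1) * ((p₂ ∸ 1) * (p₃ ∸ 1))            ∎
  where
  open ≡-Reasoning
  open +-*-Solver
  instance
    p₁≢0 : NonZero p₁
    p₁≢0 = prime⇒nonZero pp₁
    p₂≢0 : NonZero p₂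
    p₂≢0 = prime⇒nonZero pp₂
  reverse₃ : ∀ x y z → x * (y * z) ≡ z * (y * x)
  reverse₃ = solve 3 (λ x y z → x :* (y :* z) := z :* (y :* x)) refl
  p₂∤p₁ : ¬ p₂ ∣ p₁
  p₂∤p₁ = >⇒∤ p₁<p₂
  p₃∤p₂p₁ : ¬ p₃ ∣ p₂ * p₁
  p₃∤p₂p₁ p₃∣p₂p₁ with euclidsLemma p₂ p₁ pp₃ p₃∣p₂p₁
  ... | inj₁ p₃∣p₂ = >⇒∤ p₂<p₃ p₃∣p₂
  ... | inj₂ p₃∣p₁ = >⇒∤ (<-trans p₁<p₂ p₂<p₃) p₃∣p₁

-- Coefficients of polynomial operations

DegBelow : Poly → ℕ → Set
DegBelow p n = ∀ k → n ≤ k → coeff p k ≡ 0ℤ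

IsMonicOfDegree : Poly → ℕ → Set
IsMonicOfDegree p d = coeff p d ≡ 1ℤ × DegBelow p (suc d)

coeff-+P : ∀ p q k → coeff (p +P q) k ≡ coeff p k +ℤ coeff q k
coeff-+P []      q       k       = sym (ℤₚ.+-identityˡ (coeff q k))
coeff-+P (a ∷ p) []      k       = sym (ℤₚ.+-identityʳ (coeff (a ∷ p) k))
coeff-+P (a ∷ p) (b ∷ q) zero    = refl
coeff-+P (a ∷ p) (b ∷ q) (suc k) = coeff-+P p q k

coeff-map : ∀ (f : ℤ → ℤ) → f (0ℤ) ≡ 0ℤ → ∀ p k → coeff (map f p) k ≡ f (coeff p k)
coeff-map f f0≡0 []      k       = sym f0≡0
coeff-map f f0≡0 (a ∷ p) zero    = refl
coeff-map f f0≡0 (a ∷ p) (suc k) = coeff-map f f0≡0 p k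

coeff--P : ∀ p q k → coeff (p -P q) k ≡ coeff p k -ℤ coeff q k
coeff--P p q k = trans (coeff-+P p (negP q) k) (cong (coeff p k +ℤ_) (coeff-map -_ refl q k))

coeff-*P-zero : ∀ a p q → coeff ((a ∷ p) *P q) zero ≡ a *ℤ coeff q zero
coeff-*P-zero a p q = trans (coeff-+P (map (a *ℤ_) q) (0ℤ ∷ (p *P q)) zero)
                           (trans (ℤₚ.+-identityʳ _) (coeff-map (a *ℤ_) (ℤₚ.*-zeroʳ a) q zero))

coeff-*P-suc : ∀ a p q k → coeff ((a ∷ p) *P q) (suc k) ≡ a *ℤ coeff q (suc k) +ℤ coeff (p *P q) k
coeff-*P-suc a p q k = trans (coeff-+P (map (a *ℤ_) q) (0ℤ ∷ (p *P q)) (suc k))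
                            (cong (_+ℤ coeff (p *P q) k) (coeff-map (a *ℤ_) (ℤₚ.*-zeroʳ a) q (suc k)))

coeff-length≤ : ∀ p k → length p ≤ k → coeff p k ≡ 0ℤ
coeff-length≤ []      k       _         = refl
coeff-length≤ (a ∷ p) (suc k) (s≤s p≤k) = coeff-length≤ p k p≤k

coeff-monomial-≡ : ∀ s c → coeff (shift s (c ∷ [])) s ≡ c
coeff-monomial-≡ zero    c = refl
coeff-monomial-≡ (suc s) c = coeff-monomial-≡ s c

coeff-monomial-≢ : ∀ s c k → k ≢ s → coeff (shift s (c ∷ [])) k ≡ 0ℤ
coeff-monomial-≢ zero    c zero    k≢s = ⊥-elim (k≢s refl)
coeff-monomial-≢ zero    c (suc k) k≢s = refl
coeff-monomial-≢ (suc s) c zero    k≢s = refl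
coeff-monomial-≢ (suc s) c (suc k) k≢s = coeff-monomial-≢ s c k (k≢s ∘ cong suc)

coeff-monomial-*P : ∀ s c q j → coeff (shift s (c ∷ []) *P q) (s + j) ≡ c *ℤ coeff q j
coeff-monomial-*P zero    c q j = trans (coeff-+P (map (c *ℤ_) q) (0ℤ ∷ []) j)
                                        (trans (cong₂ _+ℤ_ (coeff-map (c *ℤ_) (ℤₚ.*-zeroʳ c) q j) (coeff-[0] j))
                                               (ℤₚ.+-identityʳ _))
  where
  coeff-[0] : ∀ j → coeff (0ℤ ∷ []) j ≡ 0ℤ
  coeff-[0] zero    = refl
  coeff-[0] (suc j) = refl
coeff-monomial-*P (suc s) c q j = trans (coeff-*P-suc (0ℤ) (shift s (c ∷ [])) q (s + j))
                                        (trans (ℤₚ.+-identityˡ _) (coeff-monomial-*P s c q j))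

*P-degBelow-zero : ∀ p q → DegBelow p 0 → DegBelow (p *P q) 0
*P-degBelow-zero []      q p≡0 k       _ = refl
*P-degBelow-zero (a ∷ p) q p≡0 zero    _ = trans (coeff-*P-zero a p q) (cong (_*ℤ coeff q 0) (p≡0 0 z≤n))
*P-degBelow-zero (a ∷ p) q p≡0 (suc k) _ =
  trans (coeff-*P-suc a p q k)
        (cong₂ _+ℤ_ (cong (_*ℤ coeff q (suc k)) (p≡0 0 z≤n))
                    (*P-degBelow-zero p q (λ j _ → p≡0 (suc j) z≤n) k z≤n))

*P-degBelow : ∀ p q m n → DegBelow p (suc m) → DegBelow q (suc n) → DegBelow (p *P q) (suc (m + n))
*P-degBelow []      q m       n p< q< k       _           = refl
*P-degBelow (a ∷ p) q zero    n p< q< (suc k) (s≤s n≤k)   =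
  trans (coeff-*P-suc a p q k)
        (cong₂ _+ℤ_ (trans (cong (a *ℤ_) (q< (suc k) (s≤s n≤k))) (ℤₚ.*-zeroʳ a))
                    (*P-degBelow-zero p q (λ j _ → p< (suc j) (s≤s z≤n)) k z≤n))
*P-degBelow (a ∷ p) q (suc m) n p< q< (suc k) (s≤s m+n<k) =
  trans (coeff-*P-suc a p q k)
        (cong₂ _+ℤ_ (trans (cong (a *ℤ_) (q< (suc k) (s≤s (≤-trans (m≤n+m n (suc m)) m+n<k)))) (ℤₚ.*-zeroʳ a))
                    (*P-degBelow p q m n (λ j m<j → p< (suc j) (s≤s m<j)) q< k m+n<k))

coeff-*P-top : ∀ p q m n → DegBelow p (suc m) → DegBelow q (suc n) →
               coeff (p *P q) (m + n) ≡ coeff p m *ℤ coeff q n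
coeff-*P-top []      q m       n       p<  q< = refl
coeff-*P-top (a ∷ p) q zero    zero    p<  q< = coeff-*P-zero a p q
coeff-*P-top (a ∷ p) q zero    (suc n) p<  q< =
  trans (coeff-*P-suc a p q n)
        (trans (cong (a *ℤ coeff q (suc n) +ℤ_) (*P-degBelow-zero p q (λ j _ → p< (suc j) (s≤s z≤n)) n z≤n))
               (ℤₚ.+-identityʳ _))
coeff-*P-top (a ∷ p) q (suc m) n       p<  q< =
  trans (coeff-*P-suc a p q (m + n))
        (trans (cong₂ _+ℤ_ (trans (cong (a *ℤ_) (q< (suc (m + n)) (s≤s (m≤n+m n m)))) (ℤₚ.*-zeroʳ a))
                           (coeff-*P-top p q m n (λ j m<j → p< (suc j) (s≤s m<j)) q<))
               (ℤₚ.+-identityˡ _))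

*P-monic : ∀ p q m n → IsMonicOfDegree p m → IsMonicOfDegree q n → IsMonicOfDegree (p *P q) (m + n)
*P-monic p q m n (p[m]≡1 , p<) (q[n]≡1 , q<) =
  trans (coeff-*P-top p q m n p< q<) (cong₂ _*ℤ_ p[m]≡1 q[n]≡1) , *P-degBelow p q m n p< q<

-- Trimming and long division by a monic polynomial

consTrim : ℤ → Poly → Poly
consTrim a []      = if isZero a then [] else a ∷ []
consTrim a (b ∷ p) = a ∷ b ∷ p

stripZeros : Poly → Poly
stripZeros []      = []
stripZeros (a ∷ p) = consTrim a (stripZeros p)

consTrim-∷ʳ : ∀ a ys y → consTrim a (ys ∷ʳ y) ≡ a ∷ ys ∷ʳ y
consTrim-∷ʳ a []      y = refl
consTrim-∷ʳ a (_ ∷ _) y = refl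

reverse-dropZeros-∷ʳ : ∀ xs a → reverse (dropZeros (xs ∷ʳ a)) ≡ consTrim a (reverse (dropZeros xs))
reverse-dropZeros-∷ʳ [] a with isZero a
... | true  = refl
... | false = refl
reverse-dropZeros-∷ʳ (x ∷ xs) a with isZero x
... | true  = reverse-dropZeros-∷ʳ xs a
... | false = begin
  reverse ((x ∷ xs) ∷ʳ a)      ≡⟨ reverse-++ (x ∷ xs) (a ∷ []) ⟩
  a ∷ reverse (x ∷ xs)         ≡⟨ cong (a ∷_) (unfold-reverse x xs) ⟩
  a ∷ reverse xs ∷ʳ x          ≡⟨ consTrim-∷ʳ a (reverse xs) x ⟨
  consTrim a (reverse xs ∷ʳ x) ≡⟨ cong (consTrim a) (unfold-reverse x xs) ⟨
  consTrim a (reverse (x ∷ xs)) ∎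
  where open ≡-Reasoning

trim≡stripZeros : ∀ p → trim p ≡ stripZeros p
trim≡stripZeros []      = refl
trim≡stripZeros (a ∷ p) = begin
  reverse (dropZeros (reverse (a ∷ p)))  ≡⟨ cong (reverse ∘ dropZeros) (unfold-reverse a p) ⟩
  reverse (dropZeros (reverse p ∷ʳ a))   ≡⟨ reverse-dropZeros-∷ʳ (reverse p) a ⟩
  consTrim a (trim p)                    ≡⟨ cong (consTrim a) (trim≡stripZeros p) ⟩
  consTrim a (stripZeros p)              ∎
  where open ≡-Reasoning

coeff-consTrim : ∀ a p k → coeff (consTrim a p) k ≡ coeff (a ∷ p) k
coeff-consTrim (ℤ.+ zero)    []      zero    = refl
coeff-consTrim (ℤ.+ zero)    []      (suc k) = refl
coeff-consTrim (ℤ.+ suc _)   []      k       = refl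
coeff-consTrim (ℤ.-[1+ _ ])  []      k       = refl
coeff-consTrim a             (_ ∷ _) k       = refl

coeff-stripZeros : ∀ p k → coeff (stripZeros p) k ≡ coeff p k
coeff-stripZeros []      k       = refl
coeff-stripZeros (a ∷ p) zero    = coeff-consTrim a (stripZeros p) zero
coeff-stripZeros (a ∷ p) (suc k) = trans (coeff-consTrim a (stripZeros p) (suc k)) (coeff-stripZeros p k)

length-stripZeros : ∀ p n → DegBelow p n → length (stripZeros p) ≤ n
length-stripZeros []      n       p<  = z≤n
length-stripZeros (a ∷ p) zero    p<
  with stripZeros p | length-stripZeros p 0 (λ k _ → p< (suc k) z≤n) | p< 0 z≤n
... | [] | _ | refl = z≤n
length-stripZeros (a ∷ p) (suc n) p<  =
  ≤-trans (length-consTrim a (stripZeros p)) (s≤s (length-stripZeros p n (λ k n≤k → p< (suc k) (s≤s n≤k))))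
  where
  length-consTrim : ∀ a p → length (consTrim a p) ≤ suc (length p)
  length-consTrim a []      with isZero a
  ... | true  = z≤n
  ... | false = ≤-refl
  length-consTrim a (_ ∷ _) = ≤-refl

coeff-trim : ∀ p k → coeff (trim p) k ≡ coeff p k
coeff-trim p k = trans (cong (λ q → coeff q k) (trim≡stripZeros p)) (coeff-stripZeros p k)

length-trim≤ : ∀ p n → DegBelow p n → length (trim p) ≤ n
length-trim≤ p n p< = subst (λ q → length q ≤ n) (sym (trim≡stripZeros p)) (length-stripZeros p n p<)

length-trim-monic : ∀ p d → IsMonicOfDegree p d → length (trim p) ≡ suc d
length-trim-monic p d (p[d]≡1 , p<) = ≤-antisym (length-trim≤ p (suc d) p<) (≰⇒> trim-too-short)
  where
  trim-too-short : ¬ length (trim p) ≤ d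
  trim-too-short ∣p∣≤d with trans (sym (coeff-length≤ (trim p) d ∣p∣≤d)) (trans (coeff-trim p d) p[d]≡1)
  ... | ()

lastCoeff≡coeff : ∀ p → lastCoeff p ≡ coeff p (length p ∸ 1)
lastCoeff≡coeff []           = refl
lastCoeff≡coeff (a ∷ [])     = refl
lastCoeff≡coeff (a ∷ b ∷ bs) = lastCoeff≡coeff (b ∷ bs)

trim-monic : ∀ p d → IsMonicOfDegree p d → IsMonicOfDegree (trim p) d
trim-monic p d (p[d]≡1 , p<) = trans (coeff-trim p d) p[d]≡1 , λ k d<k → trans (coeff-trim p k) (p< k d<k)

lastCoeff-trim-monic : ∀ p d → IsMonicOfDegree p d → lastCoeff (trim p) ≡ 1ℤ
lastCoeff-trim-monic p d monic = begin
  lastCoeff (trim p)                          ≡⟨ lastCoeff≡coeff (trim p) ⟩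
  coeff (trim p) (length (trim p) ∸ 1)        ≡⟨ cong (λ n → coeff (trim p) (n ∸ 1)) (length-trim-monic p d monic) ⟩
  coeff (trim p) d                            ≡⟨ proj₁ (trim-monic p d monic) ⟩
  1ℤ                                          ∎
  where open ≡-Reasoning

-P-leadingTerm-degBelow : ∀ a b c s M → IsMonicOfDegree b M → DegBelow a (suc (s + M)) → coeff a (s + M) ≡ c →
                          DegBelow (a -P shift s (c ∷ []) *P b) (s + M)
-P-leadingTerm-degBelow a b c s M (b[M]≡1 , b<) a< a[s+M]≡c k s+M≤k =
  subst (λ k → coeff r k ≡ 0ℤ) (m+[n∸m]≡n s≤k)
        (coeff-r (k ∸ s) (+-cancelˡ-≤ s M (k ∸ s) (subst (s + M ≤_) (sym (m+[n∸m]≡n s≤k)) s+M≤k)))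
  where
  open ≡-Reasoning
  r = a -P shift s (c ∷ []) *P b
  s≤k : s ≤ k
  s≤k = ≤-trans (m≤m+n s M) s+M≤k
  cancel : ∀ j → M ≤ j → coeff a (s + j) -ℤ c *ℤ coeff b j ≡ 0ℤ
  cancel j M≤j with m≤n⇒m<n∨m≡n M≤j
  ... | inj₂ refl = trans (cong₂ _-ℤ_ a[s+M]≡c (trans (cong (c *ℤ_) b[M]≡1) (ℤₚ.*-identityʳ c))) (ℤₚ.+-inverseʳ c)
  ... | inj₁ M<j  = cong₂ _-ℤ_ (a< (s + j) (subst (_≤ s + j) (+-suc s M) (+-monoʳ-≤ s M<j)))
                               (trans (cong (c *ℤ_) (b< j M<j)) (ℤₚ.*-zeroʳ c))
  coeff-r : ∀ j → M ≤ j → coeff r (s + j) ≡ 0ℤ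
  coeff-r j M≤j = begin
    coeff r (s + j)                                           ≡⟨ coeff--P a _ (s + j) ⟩
    coeff a (s + j) -ℤ coeff (shift s (c ∷ []) *P b) (s + j)
      ≡⟨ cong (coeff a (s + j) -ℤ_) (coeff-monomial-*P s c b j) ⟩
    coeff a (s + j) -ℤ c *ℤ coeff b j                         ≡⟨ cancel j M≤j ⟩
    0ℤ                                                        ∎

module LongDivision (b : Poly) (M : ℕ) (b-monic : IsMonicOfDegree b M) (∣b∣≡1+M : length b ≡ suc M) where

  leadingTerm : Poly → Poly
  leadingTerm a = shift (length (trim a) ∸ suc M) (lastCoeff (trim a) ∷ [])

  divMonic-short : ∀ f a → length (trim a) < suc M → divMonic (suc f) a b ≡ []
  divMonic-short f a ∣a∣<1+M rewrite ∣b∣≡1+M | dec-true (length (trim a) <? suc M) ∣a∣<1+M = refl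

  divMonic-step : ∀ f a → ¬ length (trim a) < suc M →
                  divMonic (suc f) a b ≡ leadingTerm a +P divMonic f (trim a -P leadingTerm a *P b) b
  divMonic-step f a ∣a∣≮1+M rewrite ∣b∣≡1+M | dec-false (length (trim a) <? suc M) ∣a∣≮1+M = refl

  private
    length≡1+s+M : ∀ a → ¬ length (trim a) < suc M → length (trim a) ≡ suc (length (trim a) ∸ suc M + M)
    length≡1+s+M a ∣a∣≮1+M = trans (sym (m∸n+n≡m (≮⇒≥ ∣a∣≮1+M))) (+-suc _ M)

  remainder-length : ∀ a → (∣a∣≮1+M : ¬ length (trim a) < suc M) →
    length (trim (trim a -P leadingTerm a *P b)) ≤ length (trim a) ∸ suc M + M
  remainder-length a ∣a∣≮1+M =
    length-trim≤ (trim a -P leadingTerm a *P b) (s + M)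
                 (-P-leadingTerm-degBelow (trim a) b (lastCoeff (trim a)) s M b-monic a< (sym lastCoeff≡a[s+M]))
    where
    s = length (trim a) ∸ suc M
    a< : DegBelow (trim a) (suc (s + M))
    a< k s+M<k = coeff-length≤ (trim a) k (subst (_≤ k) (sym (length≡1+s+M a ∣a∣≮1+M)) s+M<k)
    lastCoeff≡a[s+M] : lastCoeff (trim a) ≡ coeff (trim a) (s + M)
    lastCoeff≡a[s+M] = trans (lastCoeff≡coeff (trim a))
                             (cong (λ n → coeff (trim a) (n ∸ 1)) (length≡1+s+M a ∣a∣≮1+M))

  quotient-degBelow : ∀ f a k → length (trim a) ≤ k + M → coeff (divMonic f a b) k ≡ 0ℤ
  quotient-degBelow zero    a k _ = refl
  quotient-degBelow (suc f) a k ∣a∣≤k+M with length (trim a) <? suc M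
  ... | yes ∣a∣<1+M = cong (λ q → coeff q k) (divMonic-short f a ∣a∣<1+M)
  ... | no  ∣a∣≮1+M = begin
    coeff (divMonic (suc f) a b) k                          ≡⟨ cong (λ q → coeff q k) (divMonic-step f a ∣a∣≮1+M) ⟩
    coeff (leadingTerm a +P divMonic f r b) k               ≡⟨ coeff-+P (leadingTerm a) _ k ⟩
    coeff (leadingTerm a) k +ℤ coeff (divMonic f r b) k     ≡⟨ cong₂ _+ℤ_ (coeff-monomial-≢ s _ k (>⇒≢ s<k))
                                                                        (quotient-degBelow f r k r-short) ⟩
    0ℤ                                                      ∎
    where
    open ≡-Reasoning
    s = length (trim a) ∸ suc M
    r = trim a -P leadingTerm a *P b
    s<k : s < k
    s<k = +-cancelʳ-≤ M (suc s) k (subst (_≤ k + M) (length≡1+s+M a ∣a∣≮1+M) ∣a∣≤k+M)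
    r-short : length (trim r) ≤ k + M
    r-short = ≤-trans (remainder-length a ∣a∣≮1+M) (+-monoˡ-≤ M (<⇒≤ s<k))

  quotient-leading : ∀ f a s → length (trim a) ≡ suc (s + M) →
                     coeff (divMonic (suc f) a b) s ≡ lastCoeff (trim a)
  quotient-leading f a s ∣a∣≡1+s+M = begin
    coeff (divMonic (suc f) a b) s                        ≡⟨ cong (λ q → coeff q s) (divMonic-step f a ∣a∣≮1+M) ⟩
    coeff (leadingTerm a +P divMonic f r b) s             ≡⟨ coeff-+P (leadingTerm a) _ s ⟩
    coeff (leadingTerm a) s +ℤ coeff (divMonic f r b) s   ≡⟨ cong₂ _+ℤ_ lead (quotient-degBelow f r s r-short) ⟩
    lastCoeff (trim a) +ℤ 0ℤ                              ≡⟨ ℤₚ.+-identityʳ _ ⟩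
    lastCoeff (trim a)                                    ∎
    where
    open ≡-Reasoning
    r = trim a -P leadingTerm a *P b
    ∣a∣∸1+M≡s : length (trim a) ∸ suc M ≡ s
    ∣a∣∸1+M≡s = trans (cong (_∸ suc M) (trans ∣a∣≡1+s+M (sym (+-suc s M)))) (m+n∸n≡m s (suc M))
    ∣a∣≮1+M : ¬ length (trim a) < suc M
    ∣a∣≮1+M = ≤⇒≯ (subst (suc M ≤_) (sym ∣a∣≡1+s+M) (s≤s (m≤n+m M s)))
    lead : coeff (leadingTerm a) s ≡ lastCoeff (trim a)
    lead = subst (λ t → coeff (shift t (lastCoeff (trim a) ∷ [])) s ≡ lastCoeff (trim a)) (sym ∣a∣∸1+M≡s)
                 (coeff-monomial-≡ s _)
    r-short : length (trim r) ≤ s + M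
    r-short = subst (λ t → length (trim r) ≤ t + M) ∣a∣∸1+M≡s (remainder-length a ∣a∣≮1+M)

  divMonic-monic : ∀ f a s → IsMonicOfDegree a (s + M) → IsMonicOfDegree (divMonic (suc f) a b) s
  divMonic-monic f a s a-monic =
    trans (quotient-leading f a s ∣a∣≡1+s+M) (lastCoeff-trim-monic a (s + M) a-monic) ,
    λ k s<k → quotient-degBelow (suc f) a k (subst (_≤ k + M) (sym ∣a∣≡1+s+M) (+-monoˡ-≤ M s<k))
    where
    ∣a∣≡1+s+M : length (trim a) ≡ suc (s + M)
    ∣a∣≡1+s+M = length-trim-monic a (s + M) a-monic

-- Φ n is monic of degree φ n

cyclotomicQuotient : ℕ → Poly
cyclotomicQuotient n =
  divMonic (suc (suc n)) (xpow (suc n) -P (1ℤ ∷ [])) (trim (divisorProd (suc n) (cycTable n)))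

lookupTable-cycTable-++ : ∀ {m} n ys → n < m → lookupTable m (cycTable n ++ ys) ≡ lookupTable m ys
lookupTable-cycTable-++     zero    ys _   = refl
lookupTable-cycTable-++ {m} (suc n) ys 1+n<m = begin
  lookupTable m ((cycTable n ++ (suc n , cyclotomicQuotient n) ∷ []) ++ ys)
    ≡⟨ cong (lookupTable m) (++-assoc (cycTable n) _ ys) ⟩
  lookupTable m (cycTable n ++ (suc n , cyclotomicQuotient n) ∷ ys)
    ≡⟨ lookupTable-cycTable-++ n _ (<-trans (n<1+n n) 1+n<m) ⟩
  lookupTable m ((suc n , cyclotomicQuotient n) ∷ ys)
    ≡⟨ cong (if_then cyclotomicQuotient n else lookupTable m ys) (dec-false (suc n ≟ m) (<⇒≢ 1+n<m)) ⟩
  lookupTable m ys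
    ∎
  where open ≡-Reasoning

Φ-suc : ∀ n → Φ (suc n) ≡ cyclotomicQuotient n
Φ-suc n = trans (lookupTable-cycTable-++ n _ ≤-refl)
                (cong (if_then cyclotomicQuotient n else []) (dec-true (n ≟ n) refl))

divisorProd-monic : ∀ m n → (∀ d → d < n → IsMonicOfDegree (Φ (suc d)) (φ (suc d))) →
                    ∀ ys e → IsMonicOfDegree (divisorProd m ys) e →
                    IsMonicOfDegree (divisorProd m (cycTable n ++ ys)) (∑φ-divisors m n + e)
divisorProd-monic m zero    Φ-monic ys e ys-monic = ys-monic
divisorProd-monic m (suc n) Φ-monic ys e ys-monic =
  subst₂ IsMonicOfDegree (cong (divisorProd m) (sym (++-assoc (cycTable n) _ ys))) degree-sum
         (divisorProd-monic m n (λ d d<n → Φ-monic d (m<n⇒m<1+n d<n)) (_ ∷ ys) (x + e) step)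
  where
  x = if does (suc n ∣? m) then φ (suc n) else 0
  degree-sum : ∑φ-divisors m n + (x + e) ≡ ∑φ-divisors m (suc n) + e
  degree-sum = trans (sym (+-assoc (∑φ-divisors m n) x e)) (cong (_+ e) (+-comm (∑φ-divisors m n) x))
  step : IsMonicOfDegree (divisorProd m ((suc n , cyclotomicQuotient n) ∷ ys)) (x + e)
  step with does (suc n ∣? m)
  ... | true  = *P-monic (cyclotomicQuotient n) (divisorProd m ys) (φ (suc n)) e
                         (subst (λ p → IsMonicOfDegree p (φ (suc n))) (Φ-suc n) (Φ-monic n ≤-refl)) ys-monic
  ... | false = ys-monic

xpow-1-monic : ∀ n → IsMonicOfDegree (xpow (suc n) -P (1ℤ ∷ [])) (suc n)
xpow-1-monic n = trans (coeff--P (xpow (suc n)) (1ℤ ∷ []) (suc n)) (cong (_-ℤ 0ℤ) (coeff-monomial-≡ (suc n) 1ℤ)) ,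
                 λ { (suc k) n<k → trans (coeff--P (xpow (suc n)) (1ℤ ∷ []) (suc k))
                                         (cong (_-ℤ 0ℤ) (coeff-monomial-≢ (suc n) 1ℤ (suc k) (>⇒≢ n<k))) }

Φ-monic-below : ∀ n d → d < n → IsMonicOfDegree (Φ (suc d)) (φ (suc d))
Φ-monic-below (suc n) d d<1+n with m<1+n⇒m<n∨m≡n d<1+n
... | inj₁ d<n  = Φ-monic-below n d d<n
... | inj₂ refl = subst (λ p → IsMonicOfDegree p (φ (suc n))) (sym (Φ-suc n)) quotient-monic
  where
  m = suc n
  M = ∑φ-divisors m n
  D = divisorProd m (cycTable n)
  D-monic : IsMonicOfDegree D M
  D-monic = subst₂ (λ ys e → IsMonicOfDegree (divisorProd m ys) e) (++-identityʳ (cycTable n)) (+-identityʳ M)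
                   (divisorProd-monic m n (Φ-monic-below n) [] 0 (refl , λ { (suc k) _ → refl }))
  φ[m]+M≡m : φ m + M ≡ m
  φ[m]+M≡m = trans (cong (λ b → (if b then φ m else 0) + M) (sym (dec-true (m ∣? m) ∣-refl))) (∑φ-divisors≡id m)
  open LongDivision (trim D) M (trim-monic D M D-monic) (length-trim-monic D M D-monic)
  quotient-monic : IsMonicOfDegree (cyclotomicQuotient n) (φ m)
  quotient-monic = divMonic-monic (suc n) (xpow m -P (1ℤ ∷ [])) (φ m)
                                  (subst (IsMonicOfDegree (xpow m -P (1ℤ ∷ []))) (sym φ[m]+M≡m) (xpow-1-monic n))

Φ-monic : ∀ n .{{_ : NonZero n}} → IsMonicOfDegree (Φ n) (φ n)
Φ-monic (suc n) = Φ-monic-below (suc n) n ≤-refl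

-- Tiling coefficient windows

-- window b w c agrees with c on [b, b + w) and vanishes elsewhere.
window : ℕ → ℕ → (ℕ → ℤ) → ℕ → ℤ
window zero    zero    c k       = 0ℤ
window zero    (suc w) c zero    = c zero
window zero    (suc w) c (suc k) = window zero w (c ∘ suc) k
window (suc b) w       c zero    = 0ℤ
window (suc b) w       c (suc k) = window b w (c ∘ suc) k

window-zero : ∀ b c k → window b 0 c k ≡ 0ℤ
window-zero zero    c k       = refl
window-zero (suc b) c zero    = refl
window-zero (suc b) c (suc k) = window-zero b (c ∘ suc) k

window-+ : ∀ b u w c k → window b u c k +ℤ window (b + u) w c k ≡ window b (u + w) c k
window-+ zero    zero    w c k       = ℤₚ.+-identityˡ _
window-+ zero    (suc u) w c zero    = ℤₚ.+-identityʳ _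
window-+ zero    (suc u) w c (suc k) = window-+ zero u w (c ∘ suc) k
window-+ (suc b) u       w c zero    = refl
window-+ (suc b) u       w c (suc k) = window-+ b u w (c ∘ suc) k

coeff-shift-fromCoeffs : ∀ b w c k → coeff (shift b (fromCoeffs w (λ j → c (b + toℕ j)))) k ≡ window b w c k
coeff-shift-fromCoeffs zero    zero    c k       = refl
coeff-shift-fromCoeffs zero    (suc w) c zero    = refl
coeff-shift-fromCoeffs zero    (suc w) c (suc k) = coeff-shift-fromCoeffs zero w (c ∘ suc) k
coeff-shift-fromCoeffs (suc b) w       c zero    = refl
coeff-shift-fromCoeffs (suc b) w       c (suc k) = coeff-shift-fromCoeffs b w (c ∘ suc) k

coeff-sumP-windows : ∀ n b r {w} c {g : Fin n → Poly} → n * r ≡ w →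
                     (∀ i k → coeff (g i) k ≡ window (b + toℕ i * r) r c k) →
                     ∀ k → coeff (sumP n g) k ≡ window b w c k
coeff-sumP-windows zero    b r c     refl g≡window k = sym (window-zero b c k)
coeff-sumP-windows (suc n) b r c {g} refl g≡window k = begin
  coeff (g Fin.zero +P sumP n (g ∘ Fin.suc)) k                      ≡⟨ coeff-+P (g Fin.zero) _ k ⟩
  coeff (g Fin.zero) k +ℤ coeff (sumP n (g ∘ Fin.suc)) k            ≡⟨ cong₂ _+ℤ_ first rest ⟩
  window b r c k +ℤ window (b + r) (n * r) c k                      ≡⟨ window-+ b r (n * r) c k ⟩
  window b (r + n * r) c k                                          ∎
  where
  open ≡-Reasoning
  first : coeff (g Fin.zero) k ≡ window b r c k
  first = trans (g≡window Fin.zero k) (cong (λ o → window o r c k) (+-identityʳ b))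
  rest : coeff (sumP n (g ∘ Fin.suc)) k ≡ window (b + r) (n * r) c k
  rest = coeff-sumP-windows n (b + r) r c refl
           (λ i k → trans (g≡window (Fin.suc i) k) (cong (λ o → window o r c k) (sym (+-assoc b r (toℕ i * r)))))
           k

monic≡window+xpow : ∀ p d q → IsMonicOfDegree p d → (∀ k → coeff q k ≡ window 0 d (coeff p) k) →
                    ∀ k → coeff p k ≡ coeff (q +P xpow d) k
monic≡window+xpow p d q (p[d]≡1 , p<) q≡window k = begin
  coeff p k                                  ≡⟨ split d (coeff p) p[d]≡1 (λ k → p< k) k ⟩
  window 0 d (coeff p) k +ℤ coeff (xpow d) k ≡⟨ cong (_+ℤ coeff (xpow d) k) (q≡window k) ⟨
  coeff q k +ℤ coeff (xpow d) k              ≡⟨ coeff-+P q (xpow d) k ⟨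
  coeff (q +P xpow d) k                      ∎
  where
  open ≡-Reasoning
  split : ∀ d (c : ℕ → ℤ) → c d ≡ 1ℤ → (∀ k → d < k → c k ≡ 0ℤ) → ∀ k → c k ≡ window 0 d c k +ℤ coeff (xpow d) k
  split zero    c c[d]≡1 c≡0 zero    = c[d]≡1
  split zero    c c[d]≡1 c≡0 (suc k) = c≡0 (suc k) z<s
  split (suc d) c c[d]≡1 c≡0 zero    = sym (ℤₚ.+-identityʳ (c zero))
  split (suc d) c c[d]≡1 c≡0 (suc k) = split d (c ∘ suc) c[d]≡1 (λ k d<k → c≡0 (suc k) (s<s d<k)) k

lemma1 : (p₁ p₂ p₃ q₂ q₃ : ℕ) →
    Prime p₁ → Prime p₂ → Prime p₃ →
    ¬ (2 ∣ p₁) → ¬ (2 ∣ p₂) → ¬ (2 ∣ p₃) →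
    p₁ < p₂ → p₂ < p₃ →
    p₂ ≡ 1 + q₂ * p₁ →
    p₃ ≡ 1 + q₃ * (p₁ * p₂) →
    Σ[ f ∈ (Fin (p₁ ∸ 1) → Fin q₂ → Fin p₁ → Fin q₃ → Fin (p₁ * p₂) → ℤ) ]
      (∀ k → coeff (Φ (p₁ * p₂ * p₃)) k ≡
        coeff (sumP (p₁ ∸ 1) (λ i₁ → sumP q₂ (λ i₂ → sumP p₁ (λ i₃ → sumP q₃ (λ i₄ →
                 shift (toℕ i₁ * ((p₂ ∸ 1) * (p₃ ∸ 1)) + toℕ i₂ * (p₁ * (p₃ ∸ 1))
                          + toℕ i₃ * (p₃ ∸ 1) + toℕ i₄ * (p₁ * p₂))
                       (fromCoeffs (p₁ * p₂) (f i₁ i₂ i₃ i₄))))))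
              +P xpow (φ (p₁ * p₂ * p₃))) k)
lemma1 p₁ p₂ p₃ q₂ q₃ pp₁ pp₂ pp₃ _ _ _ p₁<p₂ p₂<p₃ p₂≡1+q₂p₁ p₃≡1+q₃p₁p₂ =
  f , monic≡window+xpow (Φ N) (φ N) blocks (Φ-monic N)
        (coeff-sumP-windows (p₁ ∸ 1) 0 ρ₁ c (sym (φ[p₁p₂p₃] pp₁ pp₂ pp₃ p₁<p₂ p₂<p₃)) λ i₁ →
         coeff-sumP-windows q₂ (toℕ i₁ * ρ₁) ρ₂ c q₂ρ₂≡ρ₁ λ i₂ →
         coeff-sumP-windows p₁ (toℕ i₁ * ρ₁ + toℕ i₂ * ρ₂) ρ₃ c refl λ i₃ →
         coeff-sumP-windows q₃ (toℕ i₁ * ρ₁ + toℕ i₂ * ρ₂ + toℕ i₃ * ρ₃) ρ₄ c q₃ρ₄≡ρ₃ λ i₄ →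
         coeff-shift-fromCoeffs (toℕ i₁ * ρ₁ + toℕ i₂ * ρ₂ + toℕ i₃ * ρ₃ + toℕ i₄ * ρ₄) ρ₄ c)
  where
  N ρ₁ ρ₂ ρ₃ ρ₄ : ℕ
  N  = p₁ * p₂ * p₃
  ρ₁ = (p₂ ∸ 1) * (p₃ ∸ 1)
  ρ₂ = p₁ * (p₃ ∸ 1)
  ρ₃ = p₃ ∸ 1
  ρ₄ = p₁ * p₂
  c : ℕ → ℤ
  c = coeff (Φ N)
  f : Fin (p₁ ∸ 1) → Fin q₂ → Fin p₁ → Fin q₃ → Fin ρ₄ → ℤ
  f i₁ i₂ i₃ i₄ j = c (toℕ i₁ * ρ₁ + toℕ i₂ * ρ₂ + toℕ i₃ * ρ₃ + toℕ i₄ * ρ₄ + toℕ j)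
  blocks : Poly
  blocks = sumP (p₁ ∸ 1) (λ i₁ → sumP q₂ (λ i₂ → sumP p₁ (λ i₃ → sumP q₃ (λ i₄ →
             shift (toℕ i₁ * ρ₁ + toℕ i₂ * ρ₂ + toℕ i₃ * ρ₃ + toℕ i₄ * ρ₄) (fromCoeffs ρ₄ (f i₁ i₂ i₃ i₄))))))
  q₂ρ₂≡ρ₁ : q₂ * ρ₂ ≡ ρ₁
  q₂ρ₂≡ρ₁ = trans (sym (*-assoc q₂ p₁ ρ₃)) (cong (λ x → (x ∸ 1) * ρ₃) (sym p₂≡1+q₂p₁))
  q₃ρ₄≡ρ₃ : q₃ * ρ₄ ≡ ρ₃
  q₃ρ₄≡ρ₃ = cong (_∸ 1) (sym p₃≡1+q₃p₁p₂)
  instance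
    N≢0 : NonZero N
    N≢0 = m*n≢0 (p₁ * p₂) p₃ {{m*n≢0 p₁ p₂ {{prime⇒nonZero pp₁}} {{prime⇒nonZero pp₂}}}} {{prime⇒nonZero pp₃}}
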